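{- For every interpretation $\llbracket\cdot\rrbracket$, all $R,S,T\in\mathsf{T}$ and $x\in\mathsf{V}$, $\llbracket\cdot\rrbracket$ satisfies the reduction statement $(\lambda xRS)T\twoheadrightarrow S_{[T/x]}$; that is, for every function $\psi$ from variables to sets, if $(\lambda xRS)T$ is well-formed with respect to $\llbracket\cdot\rrbracket_\psi$ then so is $S_{[T/x]}$ and $\llbracket(\lambda xRS)T\rrbracket_\psi=\llbracket S_{[T/x]}\rrbracket_\psi$.
   Context: Set-theoretic conventions: for sets $R,s$, $\mathrm{dom}(R)=\{d\mid\exists r\,\langle r,d\rangle\in R\}$, $R(s)=\bigcup\{r\mid\langle r,s\rangle\in R\}$; a function $F$ is a set of pairs $\langle F(d),d\rangle$; $Y^X$ is the set of functions from $X$ to $Y$; for a function $\phi$, $\prod\phi$ is the set of functions $f$ on $\mathrm{dom}(\phi)$ with $f(d)\in\phi(d)$. Terms: constants $\mathsf{C}$, variables $\mathsf{V}$; $\mathsf{T}$ is the smallest set of strings containing $\mathsf{C}\cup\mathsf{V}$ and $\beta RS$ (written $RS$) and $\lambda xRS$ for $R,S\in\mathsf{T}$, $x\in\mathsf{V}$. Free variables: $\mathsf{F}(a)=\emptyset$, $\mathsf{F}(x)=\{x\}$, $\mathsf{F}(RS)=\mathsf{F}(R)\cup\mathsf{F}(S)$, $\mathsf{F}(\lambda xRS)=\mathsf{F}(R)\cup(\mathsf{F}(S)\setminus\{x\})$. Substitution: for atomic $t$, $t_{[T/x]}=T$ if $t=x$ else $t$; $(RS)_{[T/x]}=R_{[T/x]}S_{[T/x]}$;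 $(\lambda yRS)_{[T/x]}=\lambda yR_{[T/x]}S$ if $y=x$ or $x\notin\mathsf{F}(S)$, otherwise $\lambda zR_{[T/x]}S_{[z/y][T/x]}$ with $z\notin\mathsf{F}(T)\cup(\mathsf{F}(S)\setminus\{y\})$. Among the constants are distinct sorts $\mathsf{u}_n$ and operators $\mathsf{p}_m^n$ ($m,n\in\omega$). Interpretations: any assignment of sets to variables and to constants other than the $\mathsf{p}_m^n$ extends uniquely to $\llbracket\cdot\rrbracket$ on $\mathsf{T}$ with $\llbracket\mathsf{p}_m^n\rrbracket$ the function on $\llbracket\mathsf{u}_m\rrbracket$ sending $D$ to the function on $\llbracket\mathsf{u}_n\rrbracket^D$ sending $\phi$ to $\prod\phi$; $\llbracket RS\rrbracket=\llbracket R\rrbracket(\llbracket S\rrbracket)$; $\llbracket\lambda xRS\rrbracket=\{\langle\llbracket S\rrbracket_{\langle r,x\rangle},r\rangle\mid r\in\llbracket R\rrbracket\}$, where $\llbracket\cdot\rrbracket_{\langle r,x\rangle}$ changes the assignment to $r$ at $x$; for a function $\psi$ from variables to sets, $\llbracket\cdot\rrbracket_\psi$ changes the assignment to agree with $\psi$ on its domain. Well-formedness: constants and variables are well-formed; $FS$ is well-formed iff $F$ and $S$ are, $\llbracket F\rrbracket$ is a function and $\llbracket S\rrbracket\in\mathrm{dom}\llbracket F\rrbracket$; $\lambda xRS$ is well-formed iff $R$ is and $S$ is well-formed under $\llbracket\cdot\rrbracket_{\langle r,x\rangle}$ for all $r\in\llbracket R\rrbracket$. -}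

module Defs where

open import Data.Nat using (ℕ; zero; suc; _⊔_; _≡ᵇ_; _+_)
open import Data.Bool using (Bool; true; false; if_then_else_; _∨_; not)
open import Data.List using (List; []; _∷_; _++_; foldr)
open import Data.Maybe using (Maybe; just; nothing; maybe)
open import Data.Product using (Σ; _×_; _,_; ∃)
open import Data.Sum using (_⊎_)
open import Data.Unit using (⊤)
open import Function using (id)
open import Relation.Binary.PropositionalEquality using (_≡_)

-- Set equality is
-- propositional equality on the carrier (extensionality axiom).

record ZFModel : Set₁ where
  field
    Carrier : Set
    _∈_     : Carrier → Carrier → Set
  infix 4 _∈_
  field
    ext     : ∀ {A B} → (∀ z → z ∈ A → z ∈ B) → (∀ z → z ∈ B → z ∈ A) → A ≡ B
    upair   : Carrier → Carrier → Carrier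
    upair-∈ : ∀ {a b z} → z ∈ upair a b → (z ≡ a) ⊎ (z ≡ b)
    ∈-upair : ∀ {a b z} → (z ≡ a) ⊎ (z ≡ b) → z ∈ upair a b
    ⋃       : Carrier → Carrier
    ⋃-∈     : ∀ {A z} → z ∈ ⋃ A → Σ Carrier λ y → y ∈ A × z ∈ y
    ∈-⋃     : ∀ {A z y} → y ∈ A → z ∈ y → z ∈ ⋃ A
    𝒫       : Carrier → Carrier
    𝒫-∈     : ∀ {A z} → z ∈ 𝒫 A → ∀ w → w ∈ z → w ∈ A
    ∈-𝒫     : ∀ {A z} → (∀ w → w ∈ z → w ∈ A) → z ∈ 𝒫 A
    sep     : Carrier → (Carrier → Set) → Carrier
    sep-∈   : ∀ {A P z} → z ∈ sep A P → z ∈ A × P z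
    ∈-sep   : ∀ {A P z} → z ∈ A → P z → z ∈ sep A P
    repl    : Carrier → (Carrier → Carrier) → Carrier
    repl-∈  : ∀ {A F z} → z ∈ repl A F → Σ Carrier λ a → a ∈ A × z ≡ F a
    ∈-repl  : ∀ {A F a} → a ∈ A → F a ∈ repl A F

-- Syntax.  Variables are natural numbers; the constants are the sorts
-- u n, the operators p m n, and further constants from an arbitrary
-- type K.

data Const (K : Set) : Set where
  u : ℕ → Const K
  p : ℕ → ℕ → Const K
  c : K → Const K

data Term (K : Set) : Set where
  con : Const K → Term K
  var : ℕ → Term K
  β   : Term K → Term K → Term K          -- β R S, written R S
  lam : ℕ → Term K → Term K → Term K

module _ {K : Set} where

  fv : Term K → List ℕ
  fv (con _)     = []
  fv (var x)     = x ∷ []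
  fv (β R S)     = fv R ++ fv S
  fv (lam x R S) = fv R ++ remove x (fv S)
    where
    remove : ℕ → List ℕ → List ℕ
    remove x []       = []
    remove x (y ∷ ys) = if y ≡ᵇ x then remove x ys else y ∷ remove x ys

  _∈ᵇ_ : ℕ → List ℕ → Bool
  x ∈ᵇ []       = false
  x ∈ᵇ (y ∷ ys) = (x ≡ᵇ y) ∨ (x ∈ᵇ ys)

  fresh : List ℕ → ℕ
  fresh xs = suc (foldr _⊔_ 0 xs)

  size : Term K → ℕ
  size (con _)     = 1
  size (var _)     = 1
  size (β R S)     = suc (size R + size S)
  size (lam _ R S) = suc (size R + size S)

  -- substitution with fuel (renaming preserves size, so fuel = size
  -- of the term always suffices; the zero-fuel clause is unreachable)
  sub : ℕ → Term K → ℕ → Term K → Term K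
  sub zero    T x t           = t
  sub (suc n) T x (con a)     = con a
  sub (suc n) T x (var y)     = if y ≡ᵇ x then T else var y
  sub (suc n) T x (β R S)     = β (sub n T x R) (sub n T x S)
  sub (suc n) T x (lam y R S) =
    if (y ≡ᵇ x) ∨ not (x ∈ᵇ fv S)
    then lam y (sub n T x R) S
    else lam z (sub n T x R) (sub n T x (sub n (var z) y S))
    where z = fresh (fv T ++ fv S)

  _[_/_] : Term K → Term K → ℕ → Term K
  t [ T / x ] = sub (size t) T x t

module Sem (M : ZFModel) (K : Set) where
  open ZFModel M

  sing : Carrier → Carrier
  sing a = upair a a

  _∪_ : Carrier → Carrier → Carrier
  A ∪ B = ⋃ (upair A B)

  ⟨_,_⟩ : Carrier → Carrier → Carrier
  ⟨ a , b ⟩ = upair (sing a) (upair a b)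

  dom : Carrier → Carrier
  dom R = sep (⋃ (⋃ R)) (λ d → Σ Carrier λ r → ⟨ r , d ⟩ ∈ R)

  ran : Carrier → Carrier
  ran R = sep (⋃ (⋃ R)) (λ r → Σ Carrier λ d → ⟨ r , d ⟩ ∈ R)

  infix 10 _⦅_⦆
  _⦅_⦆ : Carrier → Carrier → Carrier
  R ⦅ s ⦆ = ⋃ (sep (⋃ (⋃ R)) (λ r → ⟨ r , s ⟩ ∈ R))

  -- a function: a set of pairs ⟨ F(d) , d ⟩, single-valued
  IsFunction : Carrier → Set
  IsFunction F =
    (∀ z → z ∈ F → Σ Carrier λ r → Σ Carrier λ d → z ≡ ⟨ r , d ⟩) ×
    (∀ r r′ d → ⟨ r , d ⟩ ∈ F → ⟨ r′ , d ⟩ ∈ F → r ≡ r′)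

  exp : Carrier → Carrier → Carrier
  exp X Y = sep (𝒫 (𝒫 (𝒫 (X ∪ Y))))
    (λ f → IsFunction f × dom f ≡ X × (∀ d → d ∈ X → f ⦅ d ⦆ ∈ Y))

  ∏ : Carrier → Carrier
  ∏ φ = sep (𝒫 (𝒫 (𝒫 (dom φ ∪ ⋃ (ran φ)))))
    (λ f → IsFunction f × dom f ≡ dom φ × (∀ d → d ∈ dom φ → f ⦅ d ⦆ ∈ φ ⦅ d ⦆))

  graph : Carrier → (Carrier → Carrier) → Carrier
  graph A F = repl A (λ r → ⟨ F r , r ⟩)

  record Interp : Set where
    field
      varI  : ℕ → Carrier
      sortI : ℕ → Carrier
      constI : K → Carrier

  _[_↦_] : (ℕ → Carrier) → ℕ → Carrier → (ℕ → Carrier)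
  (ρ [ x ↦ r ]) y = if y ≡ᵇ x then r else ρ y

  -- ⟦·⟧_ψ for a (partial) function ψ from variables to sets
  override : (ℕ → Carrier) → (ℕ → Maybe Carrier) → (ℕ → Carrier)
  override ρ ψ y = maybe id (ρ y) (ψ y)

  module _ (I : Interp) where
    open Interp I

    ⟦_⟧c : Const K → Carrier
    ⟦ u n ⟧c   = sortI n
    ⟦ p m n ⟧c = graph (sortI m) (λ D → graph (exp D (sortI n)) ∏)
    ⟦ c k ⟧c   = constI k

    ⟦_⟧ : Term K → (ℕ → Carrier) → Carrier
    ⟦ con a ⟧ ρ     = ⟦ a ⟧c
    ⟦ var x ⟧ ρ     = ρ x
    ⟦ β R S ⟧ ρ     = (⟦ R ⟧ ρ) ⦅ ⟦ S ⟧ ρ ⦆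
    ⟦ lam x R S ⟧ ρ = graph (⟦ R ⟧ ρ) (λ r → ⟦ S ⟧ (ρ [ x ↦ r ]))

    WF : Term K → (ℕ → Carrier) → Set
    WF (con _) ρ     = ⊤
    WF (var _) ρ     = ⊤
    WF (β F S) ρ     = WF F ρ × WF S ρ × IsFunction (⟦ F ⟧ ρ) × (⟦ S ⟧ ρ ∈ dom (⟦ F ⟧ ρ))
    WF (lam x R S) ρ = WF R ρ × (∀ r → r ∈ ⟦ R ⟧ ρ → WF S (ρ [ x ↦ r ]))

    ρ_ : (ℕ → Maybe Carrier) → (ℕ → Carrier)
    ρ_ ψ = override varI ψ

{-# OPTIONS --safe #-}
module Submission where

-- Well-formedness of (λxRS)T puts ⟦T⟧ in ⟦R⟧, so the redex is the graph r ↦ ⟦S⟧ρ[x↦r]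
-- applied inside its domain, i.e. ⟦S⟧ρ[x↦⟦T⟧ρ].  What remains is the substitution lemma:
-- S[T/x] is well-formed at ρ whenever S is at ρ[x↦⟦T⟧ρ], with the same denotation.  It
-- goes by induction on the fuel of `sub`; the coincidence lemma (denotation and
-- well-formedness depend only on the free variables) handles the capture-avoiding
-- renaming, since the fresh variable occurs in neither S nor T.

open import Defs
open import Data.Bool using (true; false; T; _∨_; not)
open import Data.Bool.Properties using (T-≡; T-∨; T-not-≡; ∨-conicalʳ; not-injective)
open import Data.Empty using (⊥-elim)
open import Data.List using (List; _∷_; _++_; foldr)
open import Data.List.Membership.Propositional using () renaming (_∈_ to _∈ₗ_; _∉_ to _∉ₗ_)
open import Data.List.Membership.Propositional.Properties using (∈-++⁺ˡ; ∈-++⁺ʳ)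
open import Data.List.Relation.Unary.Any using (here; there)
open import Data.Maybe using (Maybe)
open import Data.Nat using (ℕ; suc; _+_; _≤_; _⊔_; _≡ᵇ_; _≟_; s≤s)
open import Data.Nat.Properties using (≡ᵇ⇒≡; ≡⇒≡ᵇ; m≤m⊔n; m≤n⊔m; ≤-refl; ≤-trans; n≮n; m+n≤o⇒m≤o; m+n≤o⇒n≤o)
open import Data.Product using (_×_; _,_; proj₁; proj₂)
open import Data.Sum using (_⊎_; inj₁; inj₂; [_,_])
open import Data.Unit using (tt)
open import Function using (id; const; _∘_; Equivalence)
open import Level using (0ℓ)
open import Relation.Binary.Core using (Rel)
open import Relation.Binary.Definitions using (Reflexive; Transitive)
open import Relation.Binary.PropositionalEquality using (_≡_; _≢_; refl; sym; trans; subst; subst₂; cong; cong₂)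
open import Relation.Nullary using (yes; no)
import Relation.Binary.Reasoning.Base.Single as SingleReasoning

open Equivalence using (to; from)

-- `_∈ᵇ_` and `fresh` carry the constant type `K` as an implicit argument they never use,
-- so it cannot be inferred and is passed explicitly.
module _ {K : Set} where

  ∈ᵇ⇒∈ : ∀ {x} xs → T (_∈ᵇ_ {K} x xs) → x ∈ₗ xs
  ∈ᵇ⇒∈ {x} (y ∷ ys) x∈ = [ here ∘ ≡ᵇ⇒≡ x y , there ∘ ∈ᵇ⇒∈ ys ] (to T-∨ x∈)

  ∈⇒∈ᵇ : ∀ {x xs} → x ∈ₗ xs → T (_∈ᵇ_ {K} x xs)
  ∈⇒∈ᵇ {x} (here refl) = from T-∨ (inj₁ (≡⇒≡ᵇ x x refl))
  ∈⇒∈ᵇ (there x∈) = from T-∨ (inj₂ (∈⇒∈ᵇ x∈))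

  ≤-foldr-⊔ : ∀ {x xs} → x ∈ₗ xs → x ≤ foldr _⊔_ 0 xs
  ≤-foldr-⊔ {xs = y ∷ ys} (here refl) = m≤m⊔n y _
  ≤-foldr-⊔ {xs = y ∷ ys} (there x∈) = ≤-trans (≤-foldr-⊔ x∈) (m≤n⊔m y _)

  fresh-∉ : ∀ xs → fresh {K} xs ∉ₗ xs
  fresh-∉ xs fresh∈ = n≮n _ (≤-foldr-⊔ fresh∈)

  ∈-fv-lamʳ : ∀ y R (S : Term K) {w} → w ∈ₗ fv S → w ≢ y → w ∈ₗ fv (lam y R S)
  ∈-fv-lamʳ y R S = λ w∈S w≢y → subst (_ ∈ₗ_) (sym fv-lam≡) (∈-++⁺ʳ (fv R) (∈-remove w∈S w≢y))
    where
    -- `fv` deletes the binder with a function local to its definition; `fv-lam≡` solves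
    -- this meta as that function.
    remove : List ℕ → List ℕ
    remove = _
    fv-lam≡ : fv (lam y R S) ≡ fv R ++ remove (fv S)
    fv-lam≡ with fv S
    ... | _ = refl
    ∈-remove : ∀ {w l} → w ∈ₗ l → w ≢ y → w ∈ₗ remove l
    ∈-remove {w} {a ∷ l} w∈ w≢y with a ≡ᵇ y in a≡ᵇy | w∈
    ... | true  | here refl = ⊥-elim (w≢y (≡ᵇ⇒≡ w y (from T-≡ a≡ᵇy)))
    ... | true  | there w∈l = ∈-remove w∈l w≢y
    ... | false | here refl = here refl
    ... | false | there w∈l = there (∈-remove w∈l w≢y)

  keep-binder⇒≡⊎∉ : ∀ {x y xs} → ((y ≡ᵇ x) ∨ not (_∈ᵇ_ {K} x xs)) ≡ true → y ≡ x ⊎ x ∉ₗ xs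
  keep-binder⇒≡⊎∉ {x} {y} cond with to T-∨ (from T-≡ cond)
  ... | inj₁ y≡ᵇx = inj₁ (≡ᵇ⇒≡ y x y≡ᵇx)
  ... | inj₂ x∉ = inj₂ λ x∈ → subst T (to T-not-≡ x∉) (∈⇒∈ᵇ x∈)

  rename-binder⇒∈ : ∀ {x y xs} → ((y ≡ᵇ x) ∨ not (_∈ᵇ_ {K} x xs)) ≡ false → x ∈ₗ xs
  rename-binder⇒∈ {y = y} {xs} cond = ∈ᵇ⇒∈ xs (from T-≡ (not-injective (∨-conicalʳ (y ≡ᵇ _) _ cond)))

  size-sub-var : ∀ (t : Term K) {n z y} → size t ≤ n → size (sub n (var z) y t) ≡ size t
  size-sub-var (con a) (s≤s _) = refl
  size-sub-var (var w) {y = y} (s≤s _) with w ≡ᵇ y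
  ... | true  = refl
  ... | false = refl
  size-sub-var (β F S) (s≤s h) =
    cong₂ (λ a b → suc (a + b)) (size-sub-var F (m+n≤o⇒m≤o _ h)) (size-sub-var S (m+n≤o⇒n≤o _ h))
  size-sub-var (lam w R S) {suc n} {z} {y} (s≤s h) with (w ≡ᵇ y) ∨ not (_∈ᵇ_ {K} y (fv S))
  ... | true  = cong (λ a → suc (a + size S)) (size-sub-var R (m+n≤o⇒m≤o _ h))
  ... | false = cong₂ (λ a b → suc (a + b)) (size-sub-var R (m+n≤o⇒m≤o _ h)) size-sub-vard
    where
    S≤ : size S ≤ n
    S≤ = m+n≤o⇒n≤o _ h
    S′ : Term K
    S′ = sub n (var (fresh {K} (z ∷ fv S))) w S
    size-S′ : size S′ ≡ size S
    size-S′ = size-sub-var S S≤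
    size-sub-vard : size (sub n (var z) y S′) ≡ size S
    size-sub-vard = trans (size-sub-var S′ (subst (_≤ n) (sym size-S′) S≤)) size-S′

module Graphs (M : ZFModel) (K : Set) where
  open ZFModel M
  open Sem M K

  ∈-sing⇒≡ : ∀ {a z} → z ∈ sing a → z ≡ a
  ∈-sing⇒≡ z∈ = [ id , id ] (upair-∈ z∈)

  ∈-upairˡ : ∀ {a b} → a ∈ upair a b
  ∈-upairˡ = ∈-upair (inj₁ refl)

  ∈-upairʳ : ∀ {a b} → b ∈ upair a b
  ∈-upairʳ = ∈-upair (inj₂ refl)

  upair≡sing⇒ˡ : ∀ {a b c} → upair a b ≡ sing c → a ≡ c
  upair≡sing⇒ˡ {a} e = ∈-sing⇒≡ (subst (a ∈_) e ∈-upairˡ)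

  upair≡sing⇒ʳ : ∀ {a b c} → upair a b ≡ sing c → b ≡ c
  upair≡sing⇒ʳ {b = b} e = ∈-sing⇒≡ (subst (b ∈_) e ∈-upairʳ)

  upair-injʳ : ∀ {a b d} → upair a b ≡ upair a d → b ≡ d
  upair-injʳ {b = b} e with upair-∈ (subst (b ∈_) e ∈-upairʳ)
  ... | inj₁ refl = sym (upair≡sing⇒ʳ (sym e))
  ... | inj₂ b≡d  = b≡d

  pair-injˡ : ∀ {a b c d} → ⟨ a , b ⟩ ≡ ⟨ c , d ⟩ → a ≡ c
  pair-injˡ {a} e with upair-∈ (subst (sing a ∈_) e ∈-upairˡ)
  ... | inj₁ a≡c  = upair≡sing⇒ˡ a≡c
  ... | inj₂ a≡cd = sym (upair≡sing⇒ˡ (sym a≡cd))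

  pair-injʳ : ∀ {a b d} → ⟨ a , b ⟩ ≡ ⟨ a , d ⟩ → b ≡ d
  pair-injʳ {a} {b} {d} e with upair-∈ (subst (upair a b ∈_) e ∈-upairʳ)
  ... | inj₂ ab≡ad = upair-injʳ ab≡ad
  ... | inj₁ ab≡aa with upair≡sing⇒ʳ ab≡aa
  ...   | refl = sym (upair≡sing⇒ʳ (∈-sing⇒≡ (subst (upair a d ∈_) (sym e) ∈-upairʳ)))

  pair-inj : ∀ {a b c d} → ⟨ a , b ⟩ ≡ ⟨ c , d ⟩ → a ≡ c × b ≡ d
  pair-inj e with pair-injˡ e
  ... | refl = refl , pair-injʳ e

  ⋃-sing : ∀ {a} → ⋃ (sing a) ≡ a
  ⋃-sing {a} = ext ⊆ (λ _ z∈a → ∈-⋃ ∈-upairˡ z∈a)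
    where
    ⊆ : ∀ z → z ∈ ⋃ (sing a) → z ∈ a
    ⊆ z z∈ with ⋃-∈ z∈
    ... | y , y∈ , z∈y = subst (z ∈_) (∈-sing⇒≡ y∈) z∈y

  dom-graph : ∀ {A F d} → d ∈ dom (graph A F) → d ∈ A
  dom-graph d∈ with sep-∈ d∈
  ... | _ , _ , rd∈ with repl-∈ rd∈
  ... | b , b∈A , rd≡ with pair-inj rd≡
  ... | _ , refl = b∈A

  graph-app : ∀ {A F a} → a ∈ A → graph A F ⦅ a ⦆ ≡ F a
  graph-app {A} {F} {a} a∈A = trans (cong ⋃ values≡) ⋃-sing
    where
    G : Carrier
    G = graph A F
    Fa,a∈G : ⟨ F a , a ⟩ ∈ G
    Fa,a∈G = ∈-repl a∈A
    ⊆ : ∀ z → z ∈ sep (⋃ (⋃ G)) (λ r → ⟨ r , a ⟩ ∈ G) → z ∈ sing (F a)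
    ⊆ z z∈ with repl-∈ (proj₂ (sep-∈ z∈))
    ... | b , _ , za≡ with pair-inj za≡
    ... | refl , refl = ∈-upairˡ
    ⊇ : ∀ z → z ∈ sing (F a) → z ∈ sep (⋃ (⋃ G)) (λ r → ⟨ r , a ⟩ ∈ G)
    ⊇ z z∈ with ∈-sing⇒≡ z∈
    ... | refl = ∈-sep (∈-⋃ (∈-⋃ Fa,a∈G ∈-upairˡ) ∈-upairˡ) Fa,a∈G
    values≡ : sep (⋃ (⋃ G)) (λ r → ⟨ r , a ⟩ ∈ G) ≡ sing (F a)
    values≡ = ext ⊆ ⊇

  graph-cong : ∀ {A B F G} → A ≡ B → (∀ r → F r ≡ G r) → graph A F ≡ graph B G
  graph-cong {A} refl F≗G = ext (⊆ F≗G) (⊆ (sym ∘ F≗G))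
    where
    ⊆ : ∀ {F G} → (∀ r → F r ≡ G r) → ∀ z → z ∈ graph A F → z ∈ graph A G
    ⊆ {G = G} F≗G z z∈ with repl-∈ z∈
    ... | b , b∈A , refl = subst (λ v → ⟨ v , b ⟩ ∈ graph A G) (sym (F≗G b)) (∈-repl b∈A)

module Substitution (M : ZFModel) (K : Set) (I : Sem.Interp M K) where
  open ZFModel M using (Carrier) renaming (_∈_ to _∈ᴹ_)
  open Sem M K hiding (⟦_⟧; WF; ρ_)
  open Graphs M K

  Env : Set
  Env = ℕ → Carrier

  ⟦_⟧ : Term K → Env → Carrier
  ⟦_⟧ = Sem.⟦_⟧ M K I

  WF : Term K → Env → Set
  WF = Sem.WF M K I

  [↦]-same : ∀ (ρ : Env) x r → (ρ [ x ↦ r ]) x ≡ r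
  [↦]-same ρ x r with x ≡ᵇ x | ≡⇒≡ᵇ x x refl
  ... | true | _ = refl

  [↦]-other : ∀ (ρ : Env) {x w} r → w ≢ x → (ρ [ x ↦ r ]) w ≡ ρ w
  [↦]-other ρ {x} {w} r w≢x with w ≡ᵇ x in w≡ᵇx
  ... | true  = ⊥-elim (w≢x (≡ᵇ⇒≡ w x (from T-≡ w≡ᵇx)))
  ... | false = refl

  infix 4 _≗[_]_
  _≗[_]_ : Env → List ℕ → Env → Set
  ρ ≗[ xs ] ρ′ = ∀ {w} → w ∈ₗ xs → ρ w ≡ ρ′ w

  ≗-[↦] : ∀ {ρ ρ′ : Env} {xs y} r → (∀ {w} → w ∈ₗ xs → w ≢ y → ρ w ≡ ρ′ w) →
    ρ [ y ↦ r ] ≗[ xs ] ρ′ [ y ↦ r ]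
  ≗-[↦] {ρ} {ρ′} {y = y} r agree {w} w∈ with w ≟ y
  ... | yes refl = trans ([↦]-same ρ w r) (sym ([↦]-same ρ′ w r))
  ... | no w≢y   = trans ([↦]-other ρ r w≢y) (trans (agree w∈ w≢y) (sym ([↦]-other ρ′ r w≢y)))

  [↦]-fresh : ∀ {ρ : Env} {xs z} r → z ∉ₗ xs → ρ [ z ↦ r ] ≗[ xs ] ρ
  [↦]-fresh {ρ} r z∉ w∈ = [↦]-other ρ r λ { refl → z∉ w∈ }

  infix 4 _↠_
  _↠_ : Rel (Term K × Env) 0ℓ
  (t , ρ) ↠ (t′ , ρ′) = (WF t ρ → WF t′ ρ′) × ⟦ t ⟧ ρ ≡ ⟦ t′ ⟧ ρ′

  ↠-refl : Reflexive _↠_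
  ↠-refl = id , refl

  ↠-trans : Transitive _↠_
  ↠-trans (wf₁ , eq₁) (wf₂ , eq₂) = wf₂ ∘ wf₁ , trans eq₁ eq₂

  module ↠-Reasoning = SingleReasoning _↠_ ↠-refl ↠-trans

  ↠-β : ∀ {F S F′ S′ ρ ρ′} → (F , ρ) ↠ (F′ , ρ′) → (S , ρ) ↠ (S′ , ρ′) →
    (β F S , ρ) ↠ (β F′ S′ , ρ′)
  ↠-β {F} {S} {F′} {S′} {ρ} {ρ′} (wf-F , F≡) (wf-S , S≡) = wf , cong₂ _⦅_⦆ F≡ S≡
    where
    wf : WF (β F S) ρ → WF (β F′ S′) ρ′
    wf (wF , wS , fun , S∈dom) =
      wf-F wF , wf-S wS , subst IsFunction F≡ fun , subst₂ (λ s f → s ∈ᴹ dom f) S≡ F≡ S∈dom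

  ↠-lam : ∀ {R S R′ S′ y y′ ρ ρ′} → (R , ρ) ↠ (R′ , ρ′) →
    (∀ r → (S , ρ [ y ↦ r ]) ↠ (S′ , ρ′ [ y′ ↦ r ])) → (lam y R S , ρ) ↠ (lam y′ R′ S′ , ρ′)
  ↠-lam {R} {S} {R′} {S′} {y} {y′} {ρ} {ρ′} (wf-R , R≡) S↠ = wf , graph-cong R≡ (proj₂ ∘ S↠)
    where
    wf : WF (lam y R S) ρ → WF (lam y′ R′ S′) ρ′
    wf (wR , wS) = wf-R wR , λ r r∈ → proj₁ (S↠ r) (wS r (subst (r ∈ᴹ_) (sym R≡) r∈))

  ↠-fv : ∀ t {ρ ρ′} → ρ ≗[ fv t ] ρ′ → (t , ρ) ↠ (t , ρ′)
  ↠-fv (con _)     _     = id , refl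
  ↠-fv (var _)     agree = id , agree (here refl)
  ↠-fv (β F S)     agree = ↠-β (↠-fv F (agree ∘ ∈-++⁺ˡ)) (↠-fv S (agree ∘ ∈-++⁺ʳ (fv F)))
  ↠-fv (lam y R S) agree =
    ↠-lam (↠-fv R (agree ∘ ∈-++⁺ˡ)) λ r → ↠-fv S (≗-[↦] r λ w∈ w≢y → agree (∈-fv-lamʳ y R S w∈ w≢y))

  ↠-sub : ∀ t {n T x ρ} → size t ≤ n → WF T ρ → (t , ρ [ x ↦ ⟦ T ⟧ ρ ]) ↠ (sub n T x t , ρ)
  ↠-sub (con _) (s≤s _) _ = id , refl
  ↠-sub (var y) {x = x} (s≤s _) wf-T with y ≡ᵇ x
  ... | true  = const wf-T , refl
  ... | false = id , refl
  ↠-sub (β F S) (s≤s h) wf-T = ↠-β (↠-sub F (m+n≤o⇒m≤o _ h) wf-T) (↠-sub S (m+n≤o⇒n≤o _ h) wf-T)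
  ↠-sub (lam y R S) {suc n} {T} {x} {ρ} (s≤s h) wf-T with (y ≡ᵇ x) ∨ not (_∈ᵇ_ {K} x (fv S)) in cond
  ... | true  = ↠-lam (↠-sub R (m+n≤o⇒m≤o _ h) wf-T) unaffected
    where
    w≢x : ∀ {w} → w ∈ₗ fv S → w ≢ y → w ≢ x
    w≢x w∈ w≢y with keep-binder⇒≡⊎∉ {K} {x} {y} {fv S} cond
    ... | inj₁ refl = w≢y
    ... | inj₂ x∉   = λ { refl → x∉ w∈ }
    unaffected : ∀ r → (S , (ρ [ x ↦ ⟦ T ⟧ ρ ]) [ y ↦ r ]) ↠ (S , ρ [ y ↦ r ])
    unaffected r = ↠-fv S (≗-[↦] r λ w∈ w≢y → [↦]-other ρ _ (w≢x w∈ w≢y))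
  ... | false = ↠-lam (↠-sub R (m+n≤o⇒m≤o _ h) wf-T) renamed
    where
    t : Carrier
    t = ⟦ T ⟧ ρ
    z : ℕ
    z = fresh {K} (fv T ++ fv S)
    z∉T : z ∉ₗ fv T
    z∉T = fresh-∉ {K} (fv T ++ fv S) ∘ ∈-++⁺ˡ
    z∉S : z ∉ₗ fv S
    z∉S = fresh-∉ {K} (fv T ++ fv S) ∘ ∈-++⁺ʳ (fv T)
    z≢x : z ≢ x
    z≢x refl = z∉S (rename-binder⇒∈ {K} {x} {y} {fv S} cond)
    S≤n : size S ≤ n
    S≤n = m+n≤o⇒n≤o _ h
    S′ : Term K
    S′ = sub n (var z) y S
    S′≤n : size S′ ≤ n
    S′≤n = subst (_≤ n) (sym (size-sub-var S S≤n)) S≤n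
    renamed : ∀ r → (S , (ρ [ x ↦ t ]) [ y ↦ r ]) ↠ (sub n T x S′ , ρ [ z ↦ r ])
    renamed r = begin
      S , (ρ [ x ↦ t ]) [ y ↦ r ]  ∼⟨ ↠-fv S σ-agree ⟩
      S , σ [ y ↦ r ]              ≡⟨ cong (λ v → S , σ [ y ↦ v ]) (sym σz≡r) ⟩
      S , σ [ y ↦ σ z ]            ∼⟨ ↠-sub S S≤n tt ⟩
      S′ , σ                       ≡⟨ cong (λ v → S′ , ρz [ x ↦ v ]) (proj₂ T↠) ⟩
      S′ , ρz [ x ↦ ⟦ T ⟧ ρz ]     ∼⟨ ↠-sub S′ S′≤n (proj₁ T↠ wf-T) ⟩
      sub n T x S′ , ρz            ∎
      where
      open ↠-Reasoning
      ρz σ : Env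
      ρz = ρ [ z ↦ r ]
      σ = ρz [ x ↦ t ]
      σ-agree : (ρ [ x ↦ t ]) [ y ↦ r ] ≗[ fv S ] σ [ y ↦ r ]
      σ-agree = ≗-[↦] r λ w∈ _ → ≗-[↦] t (λ w∈′ _ → sym ([↦]-fresh {ρ} r z∉S w∈′)) w∈
      σz≡r : σ z ≡ r
      σz≡r = trans ([↦]-other ρz t z≢x) ([↦]-same ρ z r)
      T↠ : (T , ρ) ↠ (T , ρz)
      T↠ = ↠-fv T λ w∈ → sym ([↦]-fresh {ρ} r z∉T w∈)

proposition12p2 : (M : ZFModel) (K : Set) (I : Sem.Interp M K)
    (R S T : Term K) (x : ℕ) (ψ : ℕ → Maybe (ZFModel.Carrier M)) →
    Sem.WF M K I (β (lam x R S) T) (Sem.ρ_ M K I ψ) →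
    Sem.WF M K I (S [ T / x ]) (Sem.ρ_ M K I ψ) ×
    Sem.⟦_⟧ M K I (β (lam x R S) T) (Sem.ρ_ M K I ψ) ≡ Sem.⟦_⟧ M K I (S [ T / x ]) (Sem.ρ_ M K I ψ)
proposition12p2 M K I R S T x ψ ((_ , wf-S) , wf-T , _ , T∈dom) =
  proj₁ S↠ (wf-S _ T∈R) , trans (graph-app T∈R) (proj₂ S↠)
  where
  open ZFModel M using (_∈_)
  open Sem M K using (_[_↦_])
  open Graphs M K
  open Substitution M K I
  ρ : Env
  ρ = Sem.ρ_ M K I ψ
  T∈R : ⟦ T ⟧ ρ ∈ ⟦ R ⟧ ρ
  T∈R = dom-graph T∈dom
  S↠ : (S , ρ [ x ↦ ⟦ T ⟧ ρ ]) ↠ (S [ T / x ] , ρ)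
  S↠ = ↠-sub S ≤-refl wf-T
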